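{- Let $B \geq 2$ be an integer and let $s_B(n)$ denote the sum of the digits of the $B$-ary expansion of the nonnegative integer $n$. Then $$\sum_{n \geq 1} (-1)^{s_B(n)} \sum_{1 \leq k \leq B-1} \left(\frac{1}{Bn} - \frac{(-1)^k}{Bn+k}\right) = - H_{B-1}^*$$ and $$\sum_{n \geq 1} (-1)^{s_B(n)} \sum_{0 \leq k \leq B-1} \frac{B - (-1)^k}{(Bn+k)(Bn+k+1)} = 1 + \frac{(-1)^B}{B} - 2 H_{B-1}^*.$$
   Context: $H_m^* := \sum_{1 \leq k \leq m} \frac{(-1)^{k-1}}{k}$ denotes the $m$th alternating harmonic number. -}

module Defs where

open import Data.Nat using (ℕ; zero; suc; _≤_) renaming (_+_ to _+ℕ_; _*_ to _*ℕ_)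
open import Data.Nat.DivMod using (_/_; _%_)
open import Data.Nat.Base using (NonZero)
open import Data.Integer using (+_)
open import Data.Product using (∃)
open import Data.Rational using (ℚ; 0ℚ; 1ℚ; _+_; _*_; -_; _-_; ∣_∣; _<_)
import Data.Rational as Q

-- digit sum with fuel; with fuel ≥ n and B ≥ 2 this is exact
digitSumAux : (B : ℕ) → .{{NonZero B}} → ℕ → ℕ → ℕ
digitSumAux B zero n = 0
digitSumAux B (suc fuel) zero = 0
digitSumAux B (suc fuel) n@(suc _) = (n % B) +ℕ digitSumAux B fuel (n / B)

s : (B : ℕ) → .{{NonZero B}} → ℕ → ℕ
s B n = digitSumAux B n n

ℕtoℚ : ℕ → ℚ
ℕtoℚ n = (+ n) Q./ 1

-- reciprocal 1/n of a natural number (only used with n ≠ 0; inv 0 = 0 is a dummy)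
inv : ℕ → ℚ
inv zero = 0ℚ
inv (suc n) = (+ 1) Q./ suc n

sgn : ℕ → ℚ
sgn zero = 1ℚ
sgn (suc n) = - sgn n

sumTo : ℕ → (ℕ → ℚ) → ℚ
sumTo zero f = 0ℚ
sumTo (suc n) f = sumTo n f + f n

-- alternating harmonic number H*_m = Σ_{1≤k≤m} (-1)^(k-1)/k
Hstar : ℕ → ℚ
Hstar m = sumTo m (λ j → sgn j * inv (suc j))

-- the series Σ_{n≥1} a n converges (as limit of partial sums Σ_{1≤n≤N}) to L
HasSum : (ℕ → ℚ) → ℚ → Set
HasSum a L = ∀ (ε : ℚ) → 0ℚ < ε →
  ∃ λ N → ∀ M → N ≤ M → ∣ sumTo M (λ i → a (suc i)) - L ∣ < ε

term₁ : (B : ℕ) → .{{NonZero B}} → ℕ → ℚ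
term₁ B@(suc b) n = sgn (s B n) *
  sumTo b (λ j → inv (B *ℕ n) - sgn (suc j) * inv (B *ℕ n +ℕ suc j))

term₂ : (B : ℕ) → .{{NonZero B}} → ℕ → ℚ
term₂ B n = sgn (s B n) *
  sumTo B (λ k → (ℕtoℚ B - sgn k) * inv ((B *ℕ n +ℕ k) *ℕ (B *ℕ n +ℕ k +ℕ 1)))

module Submission where

-- Write f m = (-1)^{s_B(m)}. Appending the digit r to j multiplies f by (-1)^r, i.e.
-- f (B j + r) = (-1)^r f j. Hence, for h m = f m / m and for h m = f m (1/m - 1/(m+1)), the n-th
-- summand of the first, resp. second, series is h n - Σ_{k<B} h (B n + k), and the N-th partial sum
-- telescopes to Σ_{1≤m<B} h m minus the block Σ_{N<m<B(N+1)} h m. Since f m = (-1)^m for m < B, the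
-- finite sum is the claimed closed form. The block is at most 2/(N+1) in absolute value: for the
-- second series because Σ |h m| telescopes, for the first by summation by parts, the partial sums of
-- f being bounded by 1.

open import Defs
open import Data.Nat using (ℕ; zero; suc; pred; NonZero; s≤s)
  renaming (_+_ to _+ℕ_; _*_ to _*ℕ_; _≤_ to _≤ℕ_; _<_ to _<ℕ_)
import Data.Nat.Properties as ℕ
open import Data.Nat.DivMod
  using (_/_; _%_; m/n<m; m%n<n; m≡m%n+[m/n]*n; [m+kn]%n≡m%n; m<n⇒m%n≡m; +-distrib-/-∣ʳ; m<n⇒m/n≡0; m*n/n≡m)
open import Data.Nat.Divisibility using (n∣m*n)
open import Data.Integer.Base as ℤ using (+_; +≤+; +<+)
import Data.Integer.Tactic.RingSolver as ℤ-Solver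
open import Data.Rational.Base
  using (ℚ; mkℚ; *<*; 0ℚ; 1ℚ; _+_; _*_; -_; _-_; ∣_∣; _≤_; _<_; fromℚᵘ; nonNegative)
open import Data.Rational.Properties
import Data.Rational.Unnormalised.Base as ℚᵘ
import Data.Rational.Unnormalised.Properties as ℚᵘ
open import Data.Rational.Solver using (module +-*-Solver)
open import Data.Product using (_×_; _,_; ∃)
open import Data.Sum using (_⊎_; inj₁; inj₂)
open import Data.Nat.Induction using (<-rec)
open import Data.Nat.Tactic.RingSolver using (solve-∀)
open import Relation.Binary.PropositionalEquality

open +-*-Solver

fromℚᵘ-homo-+ : ∀ p q → fromℚᵘ (p ℚᵘ.+ q) ≡ fromℚᵘ p + fromℚᵘ q
fromℚᵘ-homo-+ p q = toℚᵘ-injective (ℚᵘ.≃-trans (toℚᵘ-fromℚᵘ (p ℚᵘ.+ q)) (ℚᵘ.≃-sym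
  (ℚᵘ.≃-trans (toℚᵘ-homo-+ (fromℚᵘ p) (fromℚᵘ q))
              (ℚᵘ.+-cong (toℚᵘ-fromℚᵘ p) (toℚᵘ-fromℚᵘ q)))))

fromℚᵘ-homo-* : ∀ p q → fromℚᵘ (p ℚᵘ.* q) ≡ fromℚᵘ p * fromℚᵘ q
fromℚᵘ-homo-* p q = toℚᵘ-injective (ℚᵘ.≃-trans (toℚᵘ-fromℚᵘ (p ℚᵘ.* q)) (ℚᵘ.≃-sym
  (ℚᵘ.≃-trans (toℚᵘ-homo-* (fromℚᵘ p) (fromℚᵘ q))
              (ℚᵘ.*-cong (toℚᵘ-fromℚᵘ p) (toℚᵘ-fromℚᵘ q)))))

ℕtoℚ-suc : ∀ n → ℕtoℚ (suc n) ≡ ℕtoℚ n + 1ℚ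
ℕtoℚ-suc n = trans
  (fromℚᵘ-cong {ℚᵘ.mkℚᵘ (+ suc n) 0} {ℚᵘ.mkℚᵘ (+ n) 0 ℚᵘ.+ ℚᵘ.1ℚᵘ} (ℚᵘ.*≡* (eq (+ n))))
  (fromℚᵘ-homo-+ (ℚᵘ.mkℚᵘ (+ n) 0) ℚᵘ.1ℚᵘ)
  where
  eq : ∀ x → (+ 1 ℤ.+ x) ℤ.* + 1 ≡ (x ℤ.* + 1 ℤ.+ + 1 ℤ.* + 1) ℤ.* + 1
  eq = ℤ-Solver.solve-∀

inv-* : ∀ m n → inv (m *ℕ n) ≡ inv m * inv n
inv-* zero n = sym (*-zeroˡ (inv n))
inv-* (suc m) zero = trans (cong inv (ℕ.*-zeroʳ m)) (sym (*-zeroʳ (inv (suc m))))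
inv-* (suc m) (suc n) = fromℚᵘ-homo-* (ℚᵘ.mkℚᵘ (+ 1) m) (ℚᵘ.mkℚᵘ (+ 1) n)

ℕtoℚ*inv : ∀ n → ℕtoℚ (suc n) * inv (suc n) ≡ 1ℚ
ℕtoℚ*inv n = trans (sym (fromℚᵘ-homo-* (ℚᵘ.mkℚᵘ (+ suc n) 0) (ℚᵘ.mkℚᵘ (+ 1) n)))
  (fromℚᵘ-cong {ℚᵘ.mkℚᵘ (+ suc n) 0 ℚᵘ.* ℚᵘ.mkℚᵘ (+ 1) n} {ℚᵘ.1ℚᵘ} (ℚᵘ.*≡* (eq (+ n))))
  where
  eq : ∀ x → ((+ 1 ℤ.+ x) ℤ.* + 1) ℤ.* + 1 ≡ + 1 ℤ.* (+ 1 ℤ.* (+ 1 ℤ.+ x))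
  eq = ℤ-Solver.solve-∀

inv-pos : ∀ n → 0ℚ < inv (suc n)
inv-pos n = positive⁻¹ (inv (suc n)) {{normalize-pos 1 (suc n)}}

inv-nonNeg : ∀ n → 0ℚ ≤ inv n
inv-nonNeg zero = ≤-refl
inv-nonNeg (suc n) = <⇒≤ (inv-pos n)

inv-antitone : ∀ {m n} → m ≤ℕ n → inv (suc n) ≤ inv (suc m)
inv-antitone {m} {n} m≤n = toℚᵘ-cancel-≤
  (ℚᵘ.≤-respˡ-≃ (ℚᵘ.≃-sym (toℚᵘ-fromℚᵘ (ℚᵘ.mkℚᵘ (+ 1) n)))
    (ℚᵘ.≤-respʳ-≃ (ℚᵘ.≃-sym (toℚᵘ-fromℚᵘ (ℚᵘ.mkℚᵘ (+ 1) m)))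
      (ℚᵘ.*≤* (+≤+ (ℕ.+-monoˡ-≤ 0 (s≤s m≤n))))))

inv∘suc-antitone : ∀ m → inv (suc (suc m)) ≤ inv (suc m)
inv∘suc-antitone m = inv-antitone (ℕ.n≤1+n m)

archimedean : ∀ ε → 0ℚ < ε → ∃ λ n → inv (suc n) < ε
archimedean (mkℚ (+ zero) _ _) (*<* (+<+ ()))
archimedean (mkℚ ℤ.-[1+ _ ] _ _) (*<* ())
archimedean (mkℚ (+ suc p) d-1 _) _ = suc d-1 , toℚᵘ-cancel-<
  (ℚᵘ.<-respˡ-≃ (ℚᵘ.≃-sym (toℚᵘ-fromℚᵘ (ℚᵘ.mkℚᵘ (+ 1) (suc d-1))))
    (ℚᵘ.*<* (+<+ (ℕ.≤-trans (s≤s (s≤s (ℕ.≤-reflexive (ℕ.+-identityʳ d-1))))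
                            (ℕ.m≤n*m _ (suc p))))))

inv-halves : ∀ n → inv (2 *ℕ suc n) + inv (2 *ℕ suc n) ≡ inv (suc n)
inv-halves n = begin
  inv (2 *ℕ suc n) + inv (2 *ℕ suc n)
    ≡⟨ cong (λ x → x + x) (inv-* 2 (suc n)) ⟩
  inv 2 * inv (suc n) + inv 2 * inv (suc n)
    ≡⟨ solve 1 (λ x → con (inv 2) :* x :+ con (inv 2) :* x := x) refl (inv (suc n)) ⟩
  inv (suc n) ∎
  where open ≡-Reasoning

inv-Δ : ∀ n → inv (suc n) - inv (suc (suc n)) ≡ inv (suc n) * inv (suc (suc n))
inv-Δ n = begin
  a - c
    ≡⟨ cong₂ _-_ (sym a-as-product) (sym c-as-product) ⟩
  a * ((q + 1ℚ) * c) - c * (q * a)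
    ≡⟨ solve 3 (λ a c q → a :* ((q :+ con 1ℚ) :* c) :- c :* (q :* a) := a :* c) refl a c q ⟩
  a * c ∎
  where
  open ≡-Reasoning
  a = inv (suc n)
  c = inv (suc (suc n))
  q = ℕtoℚ (suc n)
  a-as-product : a * ((q + 1ℚ) * c) ≡ a
  a-as-product = trans (cong (λ x → a * (x * c)) (sym (ℕtoℚ-suc (suc n))))
    (trans (cong (a *_) (ℕtoℚ*inv (suc n))) (*-identityʳ a))
  c-as-product : c * (q * a) ≡ c
  c-as-product = trans (cong (c *_) (ℕtoℚ*inv n)) (*-identityʳ c)

inv-partialFraction : ∀ m → .{{NonZero m}} → inv (m *ℕ (m +ℕ 1)) ≡ inv m - inv (suc m)
inv-partialFraction (suc n) = begin
  inv (suc n *ℕ (suc n +ℕ 1))     ≡⟨ cong (λ x → inv (suc n *ℕ x)) (ℕ.+-comm (suc n) 1) ⟩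
  inv (suc n *ℕ suc (suc n))      ≡⟨ inv-* (suc n) (suc (suc n)) ⟩
  inv (suc n) * inv (suc (suc n)) ≡⟨ sym (inv-Δ n) ⟩
  inv (suc n) - inv (suc (suc n)) ∎
  where open ≡-Reasoning

ℕtoℚ*inv-* : ∀ m n → ℕtoℚ (suc m) * inv (suc m *ℕ n) ≡ inv n
ℕtoℚ*inv-* m n = begin
  ℕtoℚ (suc m) * inv (suc m *ℕ n)           ≡⟨ cong (ℕtoℚ (suc m) *_) (inv-* (suc m) n) ⟩
  ℕtoℚ (suc m) * (inv (suc m) * inv n)      ≡⟨ sym (*-assoc (ℕtoℚ (suc m)) (inv (suc m)) (inv n)) ⟩
  ℕtoℚ (suc m) * inv (suc m) * inv n        ≡⟨ cong (_* inv n) (ℕtoℚ*inv m) ⟩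
  1ℚ * inv n                                ≡⟨ *-identityˡ (inv n) ⟩
  inv n                                     ∎
  where open ≡-Reasoning

ℕtoℚ*Δinv-* : ∀ m n →
  ℕtoℚ (suc m) * (inv (suc m *ℕ n) - inv (suc m *ℕ n +ℕ suc m)) ≡ inv n - inv (suc n)
ℕtoℚ*Δinv-* m n = begin
  ℕtoℚ (suc m) * (inv (suc m *ℕ n) - inv (suc m *ℕ n +ℕ suc m))
    ≡⟨ solve 3 (λ q x y → q :* (x :- y) := q :* x :- q :* y) refl (ℕtoℚ (suc m)) (inv (suc m *ℕ n)) _ ⟩
  ℕtoℚ (suc m) * inv (suc m *ℕ n) - ℕtoℚ (suc m) * inv (suc m *ℕ n +ℕ suc m)
    ≡⟨ cong (λ x → ℕtoℚ (suc m) * inv (suc m *ℕ n) - ℕtoℚ (suc m) * inv x) (m*n+m≡m*[1+n] (suc m) n) ⟩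
  ℕtoℚ (suc m) * inv (suc m *ℕ n) - ℕtoℚ (suc m) * inv (suc m *ℕ suc n)
    ≡⟨ cong₂ _-_ (ℕtoℚ*inv-* m n) (ℕtoℚ*inv-* m (suc n)) ⟩
  inv n - inv (suc n) ∎
  where
  open ≡-Reasoning
  m*n+m≡m*[1+n] : ∀ m n → m *ℕ n +ℕ m ≡ m *ℕ suc n
  m*n+m≡m*[1+n] = solve-∀

sgn-+ : ∀ m n → sgn (m +ℕ n) ≡ sgn m * sgn n
sgn-+ zero n = sym (*-identityˡ (sgn n))
sgn-+ (suc m) n = trans (cong -_ (sgn-+ m n)) (neg-distribˡ-* (sgn m) (sgn n))

∣sgn∣≡1 : ∀ n → ∣ sgn n ∣ ≡ 1ℚ
∣sgn∣≡1 zero = refl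
∣sgn∣≡1 (suc n) = trans (∣-p∣≡∣p∣ (sgn n)) (∣sgn∣≡1 n)

sgn≡1⊎sgn≡-1 : ∀ n → sgn n ≡ 1ℚ ⊎ sgn n ≡ - 1ℚ
sgn≡1⊎sgn≡-1 zero = inj₁ refl
sgn≡1⊎sgn≡-1 (suc n) with sgn≡1⊎sgn≡-1 n
... | inj₁ eq = inj₂ (cong -_ eq)
... | inj₂ eq = inj₁ (cong -_ eq)

sumTo-cong : ∀ n {f g : ℕ → ℚ} → (∀ i → i <ℕ n → f i ≡ g i) → sumTo n f ≡ sumTo n g
sumTo-cong zero f≡g = refl
sumTo-cong (suc n) f≡g =
  cong₂ _+_ (sumTo-cong n (λ i i<n → f≡g i (ℕ.m<n⇒m<1+n i<n))) (f≡g n (ℕ.n<1+n n))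

sumTo-split : ∀ m n (f : ℕ → ℚ) → sumTo (m +ℕ n) f ≡ sumTo m f + sumTo n (λ i → f (m +ℕ i))
sumTo-split m zero f = trans (cong (λ k → sumTo k f) (ℕ.+-identityʳ m)) (sym (+-identityʳ (sumTo m f)))
sumTo-split m (suc n) f = begin
  sumTo (m +ℕ suc n) f                               ≡⟨ cong (λ k → sumTo k f) (ℕ.+-suc m n) ⟩
  sumTo (m +ℕ n) f + f (m +ℕ n)                      ≡⟨ cong (_+ f (m +ℕ n)) (sumTo-split m n f) ⟩
  sumTo m f + sumTo n (λ i → f (m +ℕ i)) + f (m +ℕ n) ≡⟨ +-assoc (sumTo m f) _ (f (m +ℕ n)) ⟩
  sumTo m f + sumTo (suc n) (λ i → f (m +ℕ i))        ∎
  where open ≡-Reasoning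

sumTo-head : ∀ n (f : ℕ → ℚ) → sumTo (suc n) f ≡ f 0 + sumTo n (λ i → f (suc i))
sumTo-head n f = trans (sumTo-split 1 n f) (cong (_+ sumTo n (λ i → f (suc i))) (+-identityˡ (f 0)))

sumTo-blocks : ∀ m n (f : ℕ → ℚ) → sumTo (m *ℕ n) f ≡ sumTo n (λ i → sumTo m (λ k → f (m *ℕ i +ℕ k)))
sumTo-blocks m zero f = cong (λ k → sumTo k f) (ℕ.*-zeroʳ m)
sumTo-blocks m (suc n) f = begin
  sumTo (m *ℕ suc n) f
    ≡⟨ cong (λ k → sumTo k f) (trans (ℕ.*-suc m n) (ℕ.+-comm m (m *ℕ n))) ⟩
  sumTo (m *ℕ n +ℕ m) f
    ≡⟨ sumTo-split (m *ℕ n) m f ⟩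
  sumTo (m *ℕ n) f + sumTo m (λ k → f (m *ℕ n +ℕ k))
    ≡⟨ cong (_+ sumTo m (λ k → f (m *ℕ n +ℕ k))) (sumTo-blocks m n f) ⟩
  sumTo (suc n) (λ i → sumTo m (λ k → f (m *ℕ i +ℕ k))) ∎
  where open ≡-Reasoning

sumTo-neg : ∀ n (f : ℕ → ℚ) → sumTo n (λ i → - f i) ≡ - sumTo n f
sumTo-neg zero f = refl
sumTo-neg (suc n) f = trans (cong (_+ - f n) (sumTo-neg n f)) (sym (neg-distrib-+ (sumTo n f) (f n)))

sumTo-- : ∀ n (f g : ℕ → ℚ) → sumTo n (λ i → f i - g i) ≡ sumTo n f - sumTo n g
sumTo-- zero f g = refl
sumTo-- (suc n) f g = trans (cong (_+ (f n - g n)) (sumTo-- n f g))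
  (solve 4 (λ a b c d → (a :- b) :+ (c :- d) := (a :+ c) :- (b :+ d)) refl
     (sumTo n f) (sumTo n g) (f n) (g n))

sumTo-*ˡ : ∀ n c (f : ℕ → ℚ) → sumTo n (λ i → c * f i) ≡ c * sumTo n f
sumTo-*ˡ zero c f = sym (*-zeroʳ c)
sumTo-*ˡ (suc n) c f = trans (cong (_+ c * f n) (sumTo-*ˡ n c f)) (sym (*-distribˡ-+ c (sumTo n f) (f n)))

sumTo-*ʳ : ∀ n c (f : ℕ → ℚ) → sumTo n (λ i → f i * c) ≡ sumTo n f * c
sumTo-*ʳ zero c f = sym (*-zeroˡ c)
sumTo-*ʳ (suc n) c f = trans (cong (_+ f n * c) (sumTo-*ʳ n c f)) (sym (*-distribʳ-+ c (sumTo n f) (f n)))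

sumTo-const : ∀ n c → sumTo n (λ _ → c) ≡ ℕtoℚ n * c
sumTo-const zero c = sym (*-zeroˡ c)
sumTo-const (suc n) c = begin
  sumTo n (λ _ → c) + c ≡⟨ cong (_+ c) (sumTo-const n c) ⟩
  ℕtoℚ n * c + c        ≡⟨ solve 2 (λ q c → q :* c :+ c := (q :+ con 1ℚ) :* c) refl (ℕtoℚ n) c ⟩
  (ℕtoℚ n + 1ℚ) * c     ≡⟨ cong (_* c) (sym (ℕtoℚ-suc n)) ⟩
  ℕtoℚ (suc n) * c      ∎
  where open ≡-Reasoning

sumTo-telescope : ∀ (w : ℕ → ℚ) n k → sumTo k (λ i → w (n +ℕ i) - w (suc (n +ℕ i))) ≡ w n - w (n +ℕ k)
sumTo-telescope w n zero = sym (trans (cong (λ j → w n - w j) (ℕ.+-identityʳ n)) (+-inverseʳ (w n)))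
sumTo-telescope w n (suc k) = begin
  sumTo k (λ i → w (n +ℕ i) - w (suc (n +ℕ i))) + (w (n +ℕ k) - w (suc (n +ℕ k)))
    ≡⟨ cong (_+ (w (n +ℕ k) - w (suc (n +ℕ k)))) (sumTo-telescope w n k) ⟩
  w n - w (n +ℕ k) + (w (n +ℕ k) - w (suc (n +ℕ k)))
    ≡⟨ solve 3 (λ a b c → (a :- b) :+ (b :- c) := a :- c) refl (w n) (w (n +ℕ k)) (w (suc (n +ℕ k))) ⟩
  w n - w (suc (n +ℕ k))
    ≡⟨ cong (λ j → w n - w j) (sym (ℕ.+-suc n k)) ⟩
  w n - w (n +ℕ suc k) ∎
  where open ≡-Reasoning

sumTo-sgn : ∀ n → sumTo n sgn + sumTo n sgn ≡ 1ℚ - sgn n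
sumTo-sgn zero = refl
sumTo-sgn (suc n) = begin
  sumTo n sgn + sgn n + (sumTo n sgn + sgn n)
    ≡⟨ solve 2 (λ e s → e :+ s :+ (e :+ s) := (e :+ e) :+ (s :+ s)) refl (sumTo n sgn) (sgn n) ⟩
  sumTo n sgn + sumTo n sgn + (sgn n + sgn n)
    ≡⟨ cong (_+ (sgn n + sgn n)) (sumTo-sgn n) ⟩
  1ℚ - sgn n + (sgn n + sgn n)
    ≡⟨ solve 1 (λ s → con 1ℚ :- s :+ (s :+ s) := con 1ℚ :- (:- s)) refl (sgn n) ⟩
  1ℚ - sgn (suc n) ∎
  where open ≡-Reasoning

p≤q⇒0≤q-p : ∀ {p q} → p ≤ q → 0ℚ ≤ q - p
p≤q⇒0≤q-p {p} {q} p≤q = subst (_≤ q - p) (+-inverseʳ p) (+-monoˡ-≤ (- p) p≤q)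

∣p*q∣≤q : ∀ p q → ∣ p ∣ ≤ 1ℚ → 0ℚ ≤ q → ∣ p * q ∣ ≤ q
∣p*q∣≤q p q ∣p∣≤1 0≤q = begin
  ∣ p * q ∣    ≡⟨ ∣p*q∣≡∣p∣*∣q∣ p q ⟩
  ∣ p ∣ * ∣ q ∣ ≡⟨ cong (∣ p ∣ *_) (0≤p⇒∣p∣≡p 0≤q) ⟩
  ∣ p ∣ * q    ≤⟨ *-monoʳ-≤-nonNeg q {{nonNegative 0≤q}} ∣p∣≤1 ⟩
  1ℚ * q       ≡⟨ *-identityˡ q ⟩
  q            ∎
  where open ≤-Reasoning

∣sumTo∣≤sumTo∣∣ : ∀ n (f : ℕ → ℚ) → ∣ sumTo n f ∣ ≤ sumTo n (λ i → ∣ f i ∣)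
∣sumTo∣≤sumTo∣∣ zero f = ≤-refl
∣sumTo∣≤sumTo∣∣ (suc n) f =
  ≤-trans (∣p+q∣≤∣p∣+∣q∣ (sumTo n f) (f n)) (+-monoˡ-≤ ∣ f n ∣ (∣sumTo∣≤sumTo∣∣ n f))

sumTo-mono-≤ : ∀ n {f g : ℕ → ℚ} → (∀ i → i <ℕ n → f i ≤ g i) → sumTo n f ≤ sumTo n g
sumTo-mono-≤ zero f≤g = ≤-refl
sumTo-mono-≤ (suc n) f≤g =
  +-mono-≤ (sumTo-mono-≤ n (λ i i<n → f≤g i (ℕ.m<n⇒m<1+n i<n))) (f≤g n (ℕ.n<1+n n))

∣sumTo-*-decrements∣≤ : ∀ (c w : ℕ → ℚ) →
  (∀ m → ∣ c m ∣ ≤ 1ℚ) → (∀ m → w (suc m) ≤ w m) → ∀ n k →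
  ∣ sumTo k (λ i → c (n +ℕ i) * (w (n +ℕ i) - w (suc (n +ℕ i)))) ∣ ≤ w n - w (n +ℕ k)
∣sumTo-*-decrements∣≤ c w ∣c∣≤1 w-antitone n k = begin
  ∣ sumTo k (λ i → c (n +ℕ i) * Δw i) ∣
    ≤⟨ ∣sumTo∣≤sumTo∣∣ k (λ i → c (n +ℕ i) * Δw i) ⟩
  sumTo k (λ i → ∣ c (n +ℕ i) * Δw i ∣)
    ≤⟨ sumTo-mono-≤ k (λ i _ → ∣p*q∣≤q _ _ (∣c∣≤1 (n +ℕ i)) (p≤q⇒0≤q-p (w-antitone (n +ℕ i)))) ⟩
  sumTo k Δw
    ≡⟨ sumTo-telescope w n k ⟩
  w n - w (n +ℕ k) ∎
  where
  open ≤-Reasoning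
  Δw : ℕ → ℚ
  Δw i = w (n +ℕ i) - w (suc (n +ℕ i))

summation-by-parts : ∀ (A w : ℕ → ℚ) n k →
  sumTo k (λ i → (A (suc (n +ℕ i)) - A (n +ℕ i)) * w (n +ℕ i))
  ≡ A (n +ℕ k) * w (n +ℕ k) - A n * w n
    + sumTo k (λ i → A (suc (n +ℕ i)) * (w (n +ℕ i) - w (suc (n +ℕ i))))
summation-by-parts A w n zero rewrite ℕ.+-identityʳ n =
  solve 2 (λ a x → con 0ℚ := a :* x :- a :* x :+ con 0ℚ) refl (A n) (w n)
summation-by-parts A w n (suc k) rewrite ℕ.+-suc n k =
  trans (cong (_+ (A (suc m) - A m) * w m) (summation-by-parts A w n k))
    (solve 7 (λ a₀ w₀ a a′ x x′ S → a :* x :- a₀ :* w₀ :+ S :+ (a′ :- a) :* x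
                                    := a′ :* x′ :- a₀ :* w₀ :+ (S :+ a′ :* (x :- x′)))
       refl (A n) (w n) (A m) (A (suc m)) (w m) (w (suc m))
       (sumTo k (λ i → A (suc (n +ℕ i)) * (w (n +ℕ i) - w (suc (n +ℕ i))))))
  where
  m = n +ℕ k

dirichlet-tail : ∀ (A w : ℕ → ℚ) →
  (∀ m → ∣ A m ∣ ≤ 1ℚ) → (∀ m → 0ℚ ≤ w m) → (∀ m → w (suc m) ≤ w m) → ∀ n k →
  ∣ sumTo k (λ i → (A (suc (n +ℕ i)) - A (n +ℕ i)) * w (n +ℕ i)) ∣ ≤ w n + w n
dirichlet-tail A w ∣A∣≤1 0≤w w-antitone n k = begin
  ∣ sumTo k (λ i → (A (suc (n +ℕ i)) - A (n +ℕ i)) * w (n +ℕ i)) ∣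
    ≡⟨ cong ∣_∣ (summation-by-parts A w n k) ⟩
  ∣ X - Y + Z ∣
    ≤⟨ ∣p+q∣≤∣p∣+∣q∣ (X - Y) Z ⟩
  ∣ X - Y ∣ + ∣ Z ∣
    ≤⟨ +-monoˡ-≤ ∣ Z ∣ (∣p-q∣≤∣p∣+∣q∣ X Y) ⟩
  ∣ X ∣ + ∣ Y ∣ + ∣ Z ∣
    ≤⟨ +-mono-≤ (+-mono-≤ (∣p*q∣≤q _ _ (∣A∣≤1 (n +ℕ k)) (0≤w (n +ℕ k)))
                          (∣p*q∣≤q _ _ (∣A∣≤1 n) (0≤w n)))
                (∣sumTo-*-decrements∣≤ (λ m → A (suc m)) w (λ m → ∣A∣≤1 (suc m)) w-antitone n k) ⟩
  w (n +ℕ k) + w n + (w n - w (n +ℕ k))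
    ≡⟨ solve 2 (λ a b → a :+ b :+ (b :- a) := b :+ b) refl (w (n +ℕ k)) (w n) ⟩
  w n + w n ∎
  where
  open ≤-Reasoning
  X = A (n +ℕ k) * w (n +ℕ k)
  Y = A n * w n
  Z = sumTo k (λ i → A (suc (n +ℕ i)) * (w (n +ℕ i) - w (suc (n +ℕ i))))

hasSum-cong : ∀ {a a′ : ℕ → ℚ} {L} → (∀ n → a (suc n) ≡ a′ (suc n)) → HasSum a L → HasSum a′ L
hasSum-cong {L = L} a≡a′ a-sum ε ε>0 with a-sum ε ε>0
... | N , close = N , λ M N≤M →
  subst (λ x → ∣ x - L ∣ < ε) (sumTo-cong M (λ i _ → a≡a′ i)) (close M N≤M)

blockDifference : ℕ → (ℕ → ℚ) → ℕ → ℚ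
blockDifference B h n = h n - sumTo B (λ k → h (B *ℕ n +ℕ k))

sumTo-blockDifference : ∀ b (h : ℕ → ℚ) N →
  sumTo N (λ i → blockDifference (suc b) h (suc i))
  ≡ sumTo b (λ i → h (suc i)) - sumTo (b *ℕ N +ℕ b) (λ i → h (suc N +ℕ i))
sumTo-blockDifference b h N = begin
  P N
    ≡⟨ P≡H N ⟩
  H N - (H (B *ℕ N +ℕ b) - H b)
    ≡⟨ cong (λ j → H N - (H j - H b)) (B*N+b≡N+[b*N+b] b N) ⟩
  H N - (H (N +ℕ (b *ℕ N +ℕ b)) - H b)
    ≡⟨ cong (λ x → H N - (x - H b)) (sumTo-split N (b *ℕ N +ℕ b) (λ i → h (suc i))) ⟩
  H N - (H N + T - H b)
    ≡⟨ solve 3 (λ x t y → x :- (x :+ t :- y) := y :- t) refl (H N) T (H b) ⟩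
  H b - T ∎
  where
  open ≡-Reasoning
  B = suc b
  H : ℕ → ℚ
  H M = sumTo M (λ i → h (suc i))
  P : ℕ → ℚ
  P M = sumTo M (λ i → blockDifference B h (suc i))
  T = sumTo (b *ℕ N +ℕ b) (λ i → h (suc N +ℕ i))
  B*N+b≡N+[b*N+b] : ∀ b N → suc b *ℕ N +ℕ b ≡ N +ℕ (b *ℕ N +ℕ b)
  B*N+b≡N+[b*N+b] = solve-∀
  B*0+b≡b : ∀ b → suc b *ℕ 0 +ℕ b ≡ b
  B*0+b≡b = solve-∀
  B*[1+N]+b≡B*N+b+B : ∀ b N → suc b *ℕ suc N +ℕ b ≡ (suc b *ℕ N +ℕ b) +ℕ suc b
  B*[1+N]+b≡B*N+b+B = solve-∀
  1+B*N+b+k≡B*[1+N]+k : ∀ b N k → suc ((suc b *ℕ N +ℕ b) +ℕ k) ≡ suc b *ℕ suc N +ℕ k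
  1+B*N+b+k≡B*[1+N]+k = solve-∀
  H-next-block : ∀ N → H (B *ℕ suc N +ℕ b) ≡ H (B *ℕ N +ℕ b) + sumTo B (λ k → h (B *ℕ suc N +ℕ k))
  H-next-block N = trans (cong H (B*[1+N]+b≡B*N+b+B b N))
    (trans (sumTo-split (B *ℕ N +ℕ b) B (λ i → h (suc i)))
      (cong (λ x → H (B *ℕ N +ℕ b) + x)
        (sumTo-cong B (λ k _ → cong h (1+B*N+b+k≡B*[1+N]+k b N k)))))
  P≡H : ∀ N → P N ≡ H N - (H (B *ℕ N +ℕ b) - H b)
  P≡H zero = begin
    0ℚ                            ≡⟨ solve 1 (λ x → con 0ℚ := con 0ℚ :- (x :- x)) refl (H b) ⟩
    0ℚ - (H b - H b)              ≡⟨ cong (λ j → 0ℚ - (H j - H b)) (sym (B*0+b≡b b)) ⟩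
    H 0 - (H (B *ℕ 0 +ℕ b) - H b) ∎
  P≡H (suc N) = begin
    P N + (h (suc N) - S)
      ≡⟨ cong (_+ (h (suc N) - S)) (P≡H N) ⟩
    H N - (H (B *ℕ N +ℕ b) - H b) + (h (suc N) - S)
      ≡⟨ solve 5 (λ x y z u s → x :- (y :- z) :+ (u :- s) := x :+ u :- (y :+ s :- z)) refl
           (H N) (H (B *ℕ N +ℕ b)) (H b) (h (suc N)) S ⟩
    H (suc N) - (H (B *ℕ N +ℕ b) + S - H b)
      ≡⟨ cong (λ x → H (suc N) - (x - H b)) (sym (H-next-block N)) ⟩
    H (suc N) - (H (B *ℕ suc N +ℕ b) - H b) ∎
    where
    S = sumTo B (λ k → h (B *ℕ suc N +ℕ k))

hasSum-blockDifference : ∀ b (h : ℕ → ℚ) →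
  (∀ n k → ∣ sumTo k (λ i → h (suc n +ℕ i)) ∣ ≤ inv (suc n) + inv (suc n)) →
  HasSum (blockDifference (suc b) h) (sumTo b (λ i → h (suc i)))
hasSum-blockDifference b h tail ε ε>0 with archimedean ε ε>0
... | n , inv<ε = N , λ M N≤M → begin-strict
  ∣ P M - L ∣                         ≡⟨ cong (λ x → ∣ x - L ∣) (sumTo-blockDifference b h M) ⟩
  ∣ L - T M - L ∣                     ≡⟨ cong ∣_∣ (solve 2 (λ l t → l :- t :- l := :- t) refl L (T M)) ⟩
  ∣ - T M ∣                           ≡⟨ ∣-p∣≡∣p∣ (T M) ⟩
  ∣ T M ∣                             ≤⟨ tail M (b *ℕ M +ℕ b) ⟩
  inv (suc M) + inv (suc M)           ≤⟨ +-mono-≤ (inv-antitone N≤M) (inv-antitone N≤M) ⟩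
  inv (2 *ℕ suc n) + inv (2 *ℕ suc n) ≡⟨ inv-halves n ⟩
  inv (suc n)                         <⟨ inv<ε ⟩
  ε                                   ∎
  where
  open ≤-Reasoning
  N = pred (2 *ℕ suc n)
  L = sumTo b (λ i → h (suc i))
  P : ℕ → ℚ
  P M = sumTo M (λ i → blockDifference (suc b) h (suc i))
  T : ℕ → ℚ
  T M = sumTo (b *ℕ M +ℕ b) (λ i → h (suc M +ℕ i))

sumTo-sgn*Δinv : ∀ m → sumTo m (λ i → sgn (suc i) * (inv (suc i) - inv (suc (suc i))))
                     ≡ 1ℚ + sgn (suc m) * inv (suc m) - ℕtoℚ 2 * Hstar m
sumTo-sgn*Δinv zero = refl
sumTo-sgn*Δinv (suc m) =
  trans (cong (_+ sgn (suc m) * (inv (suc m) - inv (suc (suc m)))) (sumTo-sgn*Δinv m))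
    (solve 4 (λ s a c H → con 1ℚ :+ (:- s) :* a :- (con 1ℚ :+ con 1ℚ) :* H :+ (:- s) :* (a :- c)
                          := con 1ℚ :+ (:- (:- s)) :* c :- (con 1ℚ :+ con 1ℚ) :* (H :+ s :* a))
       refl (sgn m) (inv (suc m)) (inv (suc (suc m))) (Hstar m))

[1+n]/[1+b]≤n : ∀ b → 1 ≤ℕ b → ∀ n → suc n / suc b ≤ℕ n
[1+n]/[1+b]≤n b b≥1 n = ℕ.≤-pred (m/n<m (suc n) (suc b) (s≤s b≥1))

digitSumAux-zero : ∀ B .{{_ : NonZero B}} fuel → digitSumAux B fuel 0 ≡ 0
digitSumAux-zero B zero = refl
digitSumAux-zero B (suc fuel) = refl

digitSumAux-fuel : ∀ b → 1 ≤ℕ b → ∀ fuel fuel′ n → n ≤ℕ fuel → n ≤ℕ fuel′ →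
  digitSumAux (suc b) fuel n ≡ digitSumAux (suc b) fuel′ n
digitSumAux-fuel b b≥1 fuel fuel′ zero _ _ =
  trans (digitSumAux-zero (suc b) fuel) (sym (digitSumAux-zero (suc b) fuel′))
digitSumAux-fuel b b≥1 (suc fuel) (suc fuel′) (suc n) (s≤s n≤fuel) (s≤s n≤fuel′) =
  cong (suc n % suc b +ℕ_) (digitSumAux-fuel b b≥1 fuel fuel′ (suc n / suc b)
    (ℕ.≤-trans ([1+n]/[1+b]≤n b b≥1 n) n≤fuel) (ℕ.≤-trans ([1+n]/[1+b]≤n b b≥1 n) n≤fuel′))

s-step : ∀ b → 1 ≤ℕ b → ∀ n → s (suc b) n ≡ n % suc b +ℕ s (suc b) (n / suc b)
s-step b b≥1 zero = refl
s-step b b≥1 (suc n) = cong (suc n % suc b +ℕ_)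
  (digitSumAux-fuel b b≥1 n (suc n / suc b) (suc n / suc b) ([1+n]/[1+b]≤n b b≥1 n) ℕ.≤-refl)

m*n+o≡o+n*m : ∀ m n o → m *ℕ n +ℕ o ≡ o +ℕ n *ℕ m
m*n+o≡o+n*m = solve-∀

s-digit : ∀ b → 1 ≤ℕ b → ∀ j r → r <ℕ suc b → s (suc b) (suc b *ℕ j +ℕ r) ≡ r +ℕ s (suc b) j
s-digit b b≥1 j r r<B = begin
  s B (B *ℕ j +ℕ r)                            ≡⟨ cong (s B) (m*n+o≡o+n*m B j r) ⟩
  s B (r +ℕ j *ℕ B)                            ≡⟨ s-step b b≥1 (r +ℕ j *ℕ B) ⟩
  (r +ℕ j *ℕ B) % B +ℕ s B ((r +ℕ j *ℕ B) / B) ≡⟨ cong₂ (λ x y → x +ℕ s B y) digit quotient ⟩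
  r +ℕ s B j                                   ∎
  where
  open ≡-Reasoning
  B = suc b
  digit : (r +ℕ j *ℕ B) % B ≡ r
  digit = trans ([m+kn]%n≡m%n r j B) (m<n⇒m%n≡m r<B)
  quotient : (r +ℕ j *ℕ B) / B ≡ j
  quotient = trans (+-distrib-/-∣ʳ r (n∣m*n j)) (cong₂ _+ℕ_ (m<n⇒m/n≡0 r<B) (m*n/n≡m j B))

module DigitSumSign (b : ℕ) (b≥1 : 1 ≤ℕ b) where

  B : ℕ
  B = suc b

  f : ℕ → ℚ
  f m = sgn (s B m)

  ∣f∣≡1 : ∀ m → ∣ f m ∣ ≡ 1ℚ
  ∣f∣≡1 m = ∣sgn∣≡1 (s B m)

  f-digit : ∀ j r → r <ℕ B → f (B *ℕ j +ℕ r) ≡ f j * sgn r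
  f-digit j r r<B =
    trans (cong sgn (s-digit b b≥1 j r r<B)) (trans (sgn-+ r (s B j)) (*-comm (sgn r) (f j)))

  f-small : ∀ r → r <ℕ B → f r ≡ sgn r
  f-small r r<B = begin
    f r                 ≡⟨ cong f (cong (_+ℕ r) (ℕ.*-zeroʳ B)) ⟨
    f (B *ℕ 0 +ℕ r)     ≡⟨ f-digit 0 r r<B ⟩
    1ℚ * sgn r          ≡⟨ *-identityˡ (sgn r) ⟩
    sgn r               ∎
    where open ≡-Reasoning

  sumTo-f-block : ∀ j r → r ≤ℕ B → sumTo r (λ k → f (B *ℕ j +ℕ k)) ≡ f j * sumTo r sgn
  sumTo-f-block j r r≤B =
    trans (sumTo-cong r (λ k k<r → f-digit j k (ℕ.<-≤-trans k<r r≤B))) (sumTo-*ˡ r (f j) sgn)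

  sumTo-f*w-block : ∀ j (w : ℕ → ℚ) →
    sumTo B (λ k → f (B *ℕ j +ℕ k) * w k) ≡ f j * sumTo B (λ k → sgn k * w k)
  sumTo-f*w-block j w = trans
    (sumTo-cong B (λ k k<B → trans (cong (_* w k) (f-digit j k k<B)) (*-assoc (f j) (sgn k) (w k))))
    (sumTo-*ˡ B (f j) (λ k → sgn k * w k))

  F : ℕ → ℚ
  F m = sumTo m f

  F-digit : ∀ j r → r <ℕ B → F (B *ℕ j +ℕ r) ≡ F j * sumTo B sgn + f j * sumTo r sgn
  F-digit j r r<B = begin
    F (B *ℕ j +ℕ r)
      ≡⟨ sumTo-split (B *ℕ j) r f ⟩
    sumTo (B *ℕ j) f + sumTo r (λ k → f (B *ℕ j +ℕ k))
      ≡⟨ cong₂ _+_ (sumTo-blocks B j f) (sumTo-f-block j r (ℕ.<⇒≤ r<B)) ⟩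
    sumTo j (λ i → sumTo B (λ k → f (B *ℕ i +ℕ k))) + f j * sumTo r sgn
      ≡⟨ cong (_+ f j * sumTo r sgn)
           (trans (sumTo-cong j (λ i _ → sumTo-f-block i B ℕ.≤-refl)) (sumTo-*ʳ j (sumTo B sgn) f)) ⟩
    F j * sumTo B sgn + f j * sumTo r sgn ∎
    where open ≡-Reasoning

  F+F+f-digit : ∀ j r → r <ℕ B →
    F (B *ℕ j +ℕ r) + F (B *ℕ j +ℕ r) + f (B *ℕ j +ℕ r) ≡ F j * (1ℚ - sgn B) + f j
  F+F+f-digit j r r<B = begin
    F m + F m + f m
      ≡⟨ cong₂ (λ x y → x + x + y) (F-digit j r r<B) (f-digit j r r<B) ⟩
    F j * E + f j * e + (F j * E + f j * e) + f j * sgn r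
      ≡⟨ solve 5 (λ x y E e σ → x :* E :+ y :* e :+ (x :* E :+ y :* e) :+ y :* σ
                                := x :* (E :+ E) :+ y :* (e :+ e :+ σ))
           refl (F j) (f j) E e (sgn r) ⟩
    F j * (E + E) + f j * (e + e + sgn r)
      ≡⟨ cong₂ (λ x y → F j * x + f j * (y + sgn r)) (sumTo-sgn B) (sumTo-sgn r) ⟩
    F j * (1ℚ - sgn B) + f j * (1ℚ - sgn r + sgn r)
      ≡⟨ cong (λ x → F j * (1ℚ - sgn B) + x)
           (solve 2 (λ y σ → y :* (con 1ℚ :- σ :+ σ) := y) refl (f j) (sgn r)) ⟩
    F j * (1ℚ - sgn B) + f j ∎
    where
    open ≡-Reasoning
    m = B *ℕ j +ℕ r
    E = sumTo B sgn
    e = sumTo r sgn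

  -- F is bounded because 2F + f only takes the values ±1, by induction on the number of digits.
  ∣F+F+f∣≤1 : ∀ m → ∣ F m + F m + f m ∣ ≤ 1ℚ
  ∣F+F+f∣≤1 = <-rec (λ m → ∣ F m + F m + f m ∣ ≤ 1ℚ) step
    where
    step : ∀ m → (∀ {j} → j <ℕ m → ∣ F j + F j + f j ∣ ≤ 1ℚ) → ∣ F m + F m + f m ∣ ≤ 1ℚ
    step zero _ = ≤-refl
    step m@(suc _) rec =
      subst (λ x → ∣ x ∣ ≤ 1ℚ)
        (sym (trans (cong (λ x → F x + F x + f x) m≡B*j+r) (F+F+f-digit j r (m%n<n m B))))
        (bound (sgn B) (sgn≡1⊎sgn≡-1 B))
      where
      j = m / B
      r = m % B
      m≡B*j+r : m ≡ B *ℕ j +ℕ r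
      m≡B*j+r = trans (m≡m%n+[m/n]*n m B) (sym (m*n+o≡o+n*m B j r))
      bound : ∀ σ → σ ≡ 1ℚ ⊎ σ ≡ - 1ℚ → ∣ F j * (1ℚ - σ) + f j ∣ ≤ 1ℚ
      bound _ (inj₁ refl) = ≤-reflexive
        (trans (cong ∣_∣ (solve 2 (λ x y → x :* (con 1ℚ :- con 1ℚ) :+ y := y) refl (F j) (f j))) (∣f∣≡1 j))
      bound _ (inj₂ refl) = subst (λ x → ∣ x ∣ ≤ 1ℚ)
        (solve 2 (λ x y → x :+ x :+ y := x :* (con 1ℚ :- (:- con 1ℚ)) :+ y) refl (F j) (f j))
        (rec (m/n<m m B (s≤s b≥1)))

  ∣F∣≤1 : ∀ m → ∣ F m ∣ ≤ 1ℚ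
  ∣F∣≤1 m = *-cancelˡ-≤-pos (ℕtoℚ 2) (begin
    ℕtoℚ 2 * ∣ F m ∣
      ≡⟨ ∣p*q∣≡∣p∣*∣q∣ (ℕtoℚ 2) (F m) ⟨
    ∣ ℕtoℚ 2 * F m ∣
      ≡⟨ cong ∣_∣ (solve 2 (λ x y → (con 1ℚ :+ con 1ℚ) :* x := x :+ x :+ y :- y) refl (F m) (f m)) ⟩
    ∣ F m + F m + f m - f m ∣
      ≤⟨ ∣p-q∣≤∣p∣+∣q∣ (F m + F m + f m) (f m) ⟩
    ∣ F m + F m + f m ∣ + ∣ f m ∣
      ≤⟨ +-mono-≤ (∣F+F+f∣≤1 m) (≤-reflexive (∣f∣≡1 m)) ⟩
    ℕtoℚ 2 * 1ℚ ∎)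
    where open ≤-Reasoning

  signedInv : ℕ → ℚ
  signedInv m = f m * inv m

  signedΔinv : ℕ → ℚ
  signedΔinv m = f m * (inv m - inv (suc m))

  term₁≡blockDifference : ∀ n → term₁ B n ≡ blockDifference B signedInv n
  term₁≡blockDifference n = begin
    term₁ B n
      ≡⟨ cong (f n *_) (trans (sumTo-- b (λ _ → I) _) (cong (_- S) (sumTo-const b I))) ⟩
    f n * (ℕtoℚ b * I - S)
      ≡⟨ solve 4 (λ x q i s → x :* (q :* i :- s) := x :* ((q :+ con 1ℚ) :* i) :- x :* (i :+ s))
           refl (f n) (ℕtoℚ b) I S ⟩
    f n * ((ℕtoℚ b + 1ℚ) * I) - f n * (I + S)
      ≡⟨ cong₂ (λ x y → f n * x - f n * y) B*I≡inv[n] I+S≡block ⟩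
    f n * inv n - f n * sumTo B (λ k → sgn k * inv (B *ℕ n +ℕ k))
      ≡⟨ cong (λ x → f n * inv n - x) (sumTo-f*w-block n (λ k → inv (B *ℕ n +ℕ k))) ⟨
    blockDifference B signedInv n ∎
    where
    open ≡-Reasoning
    I = inv (B *ℕ n)
    S = sumTo b (λ j → sgn (suc j) * inv (B *ℕ n +ℕ suc j))
    B*I≡inv[n] : (ℕtoℚ b + 1ℚ) * I ≡ inv n
    B*I≡inv[n] = trans (cong (_* I) (sym (ℕtoℚ-suc b))) (ℕtoℚ*inv-* b n)
    I+S≡block : I + S ≡ sumTo B (λ k → sgn k * inv (B *ℕ n +ℕ k))
    I+S≡block = sym (trans (sumTo-head b (λ k → sgn k * inv (B *ℕ n +ℕ k)))
      (cong (_+ S) (trans (*-identityˡ _) (cong inv (ℕ.+-identityʳ (B *ℕ n))))))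

  term₂≡blockDifference : ∀ n → term₂ B (suc n) ≡ blockDifference B signedΔinv (suc n)
  term₂≡blockDifference n = begin
    term₂ B (suc n)
      ≡⟨ cong (f (suc n) *_)
           (sumTo-cong B (λ k _ → cong ((ℕtoℚ B - sgn k) *_) (inv-partialFraction (m +ℕ k)))) ⟩
    f (suc n) * sumTo B (λ k → (ℕtoℚ B - sgn k) * Δ k)
      ≡⟨ cong (f (suc n) *_) (trans (sumTo-cong B (λ k _ → *-distrib-- (ℕtoℚ B) (sgn k) (Δ k)))
                                   (trans (sumTo-- B _ _) (cong (_- Y) (sumTo-*ˡ B (ℕtoℚ B) Δ)))) ⟩
    f (suc n) * (ℕtoℚ B * sumTo B Δ - Y)
      ≡⟨ cong (λ x → f (suc n) * (ℕtoℚ B * x - Y)) (sumTo-telescope inv m B) ⟩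
    f (suc n) * (ℕtoℚ B * (inv m - inv (m +ℕ B)) - Y)
      ≡⟨ cong (λ x → f (suc n) * (x - Y)) (ℕtoℚ*Δinv-* b (suc n)) ⟩
    f (suc n) * (inv (suc n) - inv (suc (suc n)) - Y)
      ≡⟨ solve 3 (λ x d y → x :* (d :- y) := x :* d :- x :* y)
           refl (f (suc n)) (inv (suc n) - inv (suc (suc n))) Y ⟩
    signedΔinv (suc n) - f (suc n) * Y
      ≡⟨ cong (λ x → signedΔinv (suc n) - x) (sumTo-f*w-block (suc n) Δ) ⟨
    blockDifference B signedΔinv (suc n) ∎
    where
    open ≡-Reasoning
    m = B *ℕ suc n
    Δ : ℕ → ℚ
    Δ k = inv (m +ℕ k) - inv (suc (m +ℕ k))
    Y = sumTo B (λ k → sgn k * Δ k)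
    *-distrib-- : ∀ p q x → (p - q) * x ≡ p * x - q * x
    *-distrib-- p q x = solve 3 (λ p q x → (p :- q) :* x := p :* x :- q :* x) refl p q x

  sumTo-signedInv : sumTo b (λ i → signedInv (suc i)) ≡ - Hstar b
  sumTo-signedInv = trans
    (sumTo-cong b (λ i i<b → trans (cong (_* inv (suc i)) (f-small (suc i) (s≤s i<b)))
                                   (sym (neg-distribˡ-* (sgn i) (inv (suc i))))))
    (sumTo-neg b (λ i → sgn i * inv (suc i)))

  sumTo-signedΔinv : sumTo b (λ i → signedΔinv (suc i)) ≡ 1ℚ + sgn B * inv B - ℕtoℚ 2 * Hstar b
  sumTo-signedΔinv = trans
    (sumTo-cong b (λ i i<b → cong (_* (inv (suc i) - inv (suc (suc i)))) (f-small (suc i) (s≤s i<b))))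
    (sumTo-sgn*Δinv b)

  signedInv-tail : ∀ n k → ∣ sumTo k (λ i → signedInv (suc n +ℕ i)) ∣ ≤ inv (suc n) + inv (suc n)
  signedInv-tail n k = subst (λ x → ∣ x ∣ ≤ inv (suc n) + inv (suc n))
    (sumTo-cong k (λ i _ → cong (_* inv (suc (n +ℕ i)))
      (solve 2 (λ x y → x :+ y :- x := y) refl (F (suc (n +ℕ i))) (f (suc (n +ℕ i))))))
    (dirichlet-tail (λ m → F (suc m)) (λ m → inv (suc m)) (λ m → ∣F∣≤1 (suc m))
                    (λ m → inv-nonNeg (suc m)) inv∘suc-antitone n k)

  signedΔinv-tail : ∀ n k → ∣ sumTo k (λ i → signedΔinv (suc n +ℕ i)) ∣ ≤ inv (suc n) + inv (suc n)
  signedΔinv-tail n k = ≤-trans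
    (∣sumTo-*-decrements∣≤ (λ m → f (suc m)) (λ m → inv (suc m)) (λ m → ≤-reflexive (∣f∣≡1 (suc m)))
                           inv∘suc-antitone n k)
    (+-monoʳ-≤ (inv (suc n))
      (≤-trans (neg-antimono-≤ (inv-nonNeg (suc (n +ℕ k)))) (inv-nonNeg (suc n))))

corollary8 : (b : ℕ) → 2 ≤ℕ suc b →
    HasSum (term₁ (suc b)) (- Hstar b)
    × HasSum (term₂ (suc b)) (1ℚ + sgn (suc b) * inv (suc b) - ℕtoℚ 2 * Hstar b)
corollary8 b 2≤B =
    subst (HasSum (term₁ B)) sumTo-signedInv
      (hasSum-cong {blockDifference B signedInv} {term₁ B} (λ n → sym (term₁≡blockDifference (suc n)))
        (hasSum-blockDifference b signedInv signedInv-tail))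
  , subst (HasSum (term₂ B)) sumTo-signedΔinv
      (hasSum-cong {blockDifference B signedΔinv} {term₂ B} (λ n → sym (term₂≡blockDifference n))
        (hasSum-blockDifference b signedΔinv signedΔinv-tail))
  where open DigitSumSign b (ℕ.≤-pred 2≤B)
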